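{- Let $n\ge2$ and let $\mathrm{front}:[1,n]\to[1,n+1]\cup\{\mathrm{nil}\}$ be the partial map maintained by the on-the-fly pointers-tree generator at some time, so that: $\mathrm{front}(i)>i$ whenever $\mathrm{front}(i)\ne\mathrm{nil}$; for each $x\in[1,n]$ at most one $i$ has $\mathrm{front}(i)=x$; and (Invariant) for every $j$, $\mathrm{front}(j)\ne\mathrm{nil}$ implies $\mathrm{front}(\mathrm{front}(j))\ne\mathrm{nil}$. For $x\in[1,n]$ let $\mathrm{front}^{ -1}(x)$ be the unique $i$ with $\mathrm{front}(i)=x$, or $\mathrm{nil}$ if none; let $\Phi(x)=\{i<x:\mathrm{front}(i)=\mathrm{nil}\text{ or }\mathrm{front}(i)<x\}$, $\varphi(x)=|\Phi(x)|$, and $K=\{i:\mathrm{front}(i)\ne\mathrm{nil}\text{ and }\mathrm{front}^{ -1}(i)=\mathrm{nil}\}$. Then for every $x\in[1,n-1]$: (1) $\Phi(x)\subseteq\Phi(x+1)\subseteq\Phi(x)\cup\{x,\mathrm{front}^{ -1}(x)\}$; (2) $\Phi(x+1)=\Phi(x)$ if and only if $x\in K$; (3) $\varphi(x+1)-\varphi(x)\le1$.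
   Context: In the on-the-fly pointers-tree generator, each node $i\in[2,n]$ of the pointers tree has a pointer $u(i)\in[1,i-1]$ revealed lazily, and $\mathrm{front}(i)$ denotes the largest node returned so far as a $u$-child of $i$ by the internal procedure $\texttt{next-child}(i)$ (or $\mathrm{nil}$ if none); thus $\mathrm{front}(i)=x$ implies $u(x)=i$. The generator maintains the Invariant stated in the claim by issuing an internal $\texttt{next-child}(\mathrm{front}(j))$ call whenever $\mathrm{front}(j)$ is updated, node $n+1$ being the base case (treated as having $\mathrm{front}(n+1)\ne\mathrm{nil}$). The set $\Phi(x)$ equals $[1,x-1]$ minus the set of $i<x$ with $\mathrm{front}(i)\ge x$. -}

module Defs where

open import Data.Nat using (ℕ; zero; suc; _+_; _≤_; _<_; _≤?_; _<?_)
open import Data.Maybe using (Maybe; just; nothing)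
open import Data.List using (List; length; filter; upTo)
open import Data.Product using (Σ; ∃; _×_; _,_; proj₁; proj₂)
open import Data.Sum using (_⊎_; inj₁; inj₂)
open import Relation.Nullary using (Dec; yes; no; ¬_)
open import Relation.Binary.PropositionalEquality using (_≡_; refl; sym; trans)
open import Data.Maybe.Properties using (just-injective)

-- A front map: nodes i ∈ [1,n] are sent to `nothing` (nil) or `just y`.
-- Values at indices outside [1,n] are irrelevant (never consulted).
Front : Set
Front = ℕ → Maybe ℕ

Φ : Front → ℕ → ℕ → Set
Φ front x i = 1 ≤ i × i < x × (front i ≡ nothing ⊎ ∃ λ y → front i ≡ just y × y < x)

private
  frontDec : (m : Maybe ℕ) (x : ℕ) → Dec (m ≡ nothing ⊎ ∃ λ y → m ≡ just y × y < x)
  frontDec nothing x = yes (inj₁ refl)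
  frontDec (just y) x with y <? x
  ... | yes p = yes (inj₂ (y , refl , p))
  ... | no ¬p = no λ { (inj₁ ()) ; (inj₂ (z , refl , q)) → ¬p q }

Φ? : (front : Front) (x i : ℕ) → Dec (Φ front x i)
Φ? front x i with 1 ≤? i | suc i ≤? x | frontDec (front i) x
... | yes a | yes b | yes c = yes (a , b , c)
... | no ¬a | _ | _ = no λ p → ¬a (proj₁ p)
... | yes _ | no ¬b | _ = no λ p → ¬b (proj₁ (proj₂ p))
... | yes _ | yes _ | no ¬c = no λ p → ¬c (proj₂ (proj₂ p))

-- φ(x) = |Φ(x)|  (Φ(x) ⊆ [1,x-1] ⊆ upTo x = [0..x-1])
φ : Front → ℕ → ℕ
φ front x = length (filter (Φ? front x) (upTo x))

IsFrontInv : ℕ → Front → ℕ → ℕ → Set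
IsFrontInv n front x i = 1 ≤ i × i ≤ n × front i ≡ just x

InK : ℕ → Front → ℕ → Set
InK n front i = 1 ≤ i × i ≤ n × ¬ (front i ≡ nothing) × (∀ j → ¬ IsFrontInv n front i j)

record ValidFront (n : ℕ) (front : Front) : Set where
  field
    range    : ∀ i y → 1 ≤ i → i ≤ n → front i ≡ just y → i < y × y ≤ suc n
    atMostOne : ∀ x i j → 1 ≤ x → x ≤ n → 1 ≤ i → i ≤ n → 1 ≤ j → j ≤ n →
                front i ≡ just x → front j ≡ just x → i ≡ j
    -- Invariant: front(j) ≠ nil ⇒ front(front(j)) ≠ nil  (front(n+1) ≠ nil by convention)
    invariant : ∀ j y → 1 ≤ j → j ≤ n → front j ≡ just y →
                y ≡ suc n ⊎ ¬ (front y ≡ nothing)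

-- A node i < x leaves Φ only by having front(i) reach x, so passing from x to x+1 can add
-- only x itself (when front(x) = nil) or front⁻¹(x). By the Invariant these two candidates
-- exclude each other: front⁻¹(x) existing forces front(x) ≠ nil. Hence at most one node is
-- added, and none exactly when front(x) ≠ nil and front⁻¹(x) = nil, i.e. x ∈ K.
module Submission where

open import Defs
open import Data.Nat using (ℕ; suc; _≤_; _<_; _+_; z≤n; s≤s)
open import Data.Nat.Properties
  using (≤-refl; ≤-trans; ≤-reflexive; <⇒≤; <-irrefl; <-≤-trans; m<n⇒m<1+n; m≤n⇒m<n∨m≡n;
         +-comm; +-suc; +-monoʳ-≤; n≤1+n)
open import Data.Product using (_×_; _,_; proj₁)
open import Data.Sum using (_⊎_; inj₁; inj₂)
open import Data.Maybe using (just; nothing)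
open import Data.Empty using (⊥-elim)
open import Data.List using ([]; _∷_; _++_; [_]; length; filter; upTo)
open import Data.List.Properties using (upTo-∷ʳ; filter-++; filter-reject; filter-none; ++-identityʳ)
open import Data.List.Relation.Unary.All as All using ()
open import Data.List.Relation.Unary.Unique.Propositional using (Unique; []; _∷_)
open import Data.List.Relation.Unary.Unique.Propositional.Properties using (upTo⁺)
open import Function.Bundles using (_⇔_; mk⇔; Equivalence)
open import Relation.Nullary using (yes; no; ¬_)
open import Relation.Unary using (Pred; Decidable; _∩_; ∁)
open import Relation.Unary.Properties using (_∩?_; ∁?)
open import Relation.Binary.PropositionalEquality using (_≡_; _≢_; refl; sym; trans; cong; module ≡-Reasoning)

module _ {a p q} {A : Set a} {P : Pred A p} {Q : Pred A q}
         (P? : Decidable P) (Q? : Decidable Q) where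

  length-filter-≤-+-∖ : ∀ xs →
    length (filter P? xs) ≤ length (filter Q? xs) + length (filter (P? ∩? ∁? Q?) xs)
  length-filter-≤-+-∖ [] = z≤n
  length-filter-≤-+-∖ (y ∷ xs) with P? y | Q? y
  ... | yes _ | yes _ = s≤s (length-filter-≤-+-∖ xs)
  ... | yes _ | no _  = ≤-trans (s≤s (length-filter-≤-+-∖ xs)) (≤-reflexive (sym (+-suc _ _)))
  ... | no _  | yes _ = ≤-trans (length-filter-≤-+-∖ xs) (n≤1+n _)
  ... | no _  | no _  = length-filter-≤-+-∖ xs

module _ {a r} {A : Set a} {R : Pred A r} (R? : Decidable R) where

  length-filter-≤1 : (∀ {u v} → R u → R v → u ≡ v) →
    ∀ {xs} → Unique xs → length (filter R? xs) ≤ 1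
  length-filter-≤1 R-unique [] = z≤n
  length-filter-≤1 R-unique {y ∷ xs} (y∉xs ∷ unique-xs) with R? y
  ... | yes Ry = ≤-reflexive (cong (λ ys → suc (length ys)) (filter-none R? (All.map ¬R y∉xs)))
    where
    ¬R : ∀ {z} → y ≢ z → ¬ R z
    ¬R y≢z Rz = y≢z (R-unique Ry Rz)
  ... | no _ = length-filter-≤1 R-unique unique-xs

module _ {r} {R : Pred ℕ r} (R? : Decidable R) where

  length-filter-upTo-suc : ∀ {m} → ¬ R m →
    length (filter R? (upTo (suc m))) ≡ length (filter R? (upTo m))
  length-filter-upTo-suc {m} ¬Rm = begin
    length (filter R? (upTo (suc m)))
      ≡⟨ cong (λ ys → length (filter R? ys)) (sym (upTo-∷ʳ m)) ⟩
    length (filter R? (upTo m ++ [ m ]))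
      ≡⟨ cong length (filter-++ R? (upTo m) [ m ]) ⟩
    length (filter R? (upTo m) ++ filter R? [ m ])
      ≡⟨ cong (λ ys → length (filter R? (upTo m) ++ ys)) (filter-reject R? ¬Rm) ⟩
    length (filter R? (upTo m) ++ [])
      ≡⟨ cong length (++-identityʳ (filter R? (upTo m))) ⟩
    length (filter R? (upTo m))
      ∎
    where open ≡-Reasoning

length-filter-≤-suc : ∀ {a p q} {A : Set a} {P : Pred A p} {Q : Pred A q}
  (P? : Decidable P) (Q? : Decidable Q) →
  (∀ {u v} → (P ∩ ∁ Q) u → (P ∩ ∁ Q) v → u ≡ v) →
  ∀ {xs} → Unique xs → length (filter P? xs) ≤ suc (length (filter Q? xs))
length-filter-≤-suc P? Q? new-unique {xs} unique-xs = begin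
  length (filter P? xs)
    ≤⟨ length-filter-≤-+-∖ P? Q? xs ⟩
  length (filter Q? xs) + length (filter (P? ∩? ∁? Q?) xs)
    ≤⟨ +-monoʳ-≤ _ (length-filter-≤1 (P? ∩? ∁? Q?) new-unique unique-xs) ⟩
  length (filter Q? xs) + 1
    ≡⟨ +-comm _ 1 ⟩
  suc (length (filter Q? xs))
    ∎
  where open Data.Nat.Properties.≤-Reasoning

module ΦStep (front : Front) (x : ℕ) where

  Φ-irrefl : ¬ Φ front x x
  Φ-irrefl (_ , x<x , _) = <-irrefl refl x<x

  Φ-suc⁺ : ∀ i → Φ front x i → Φ front (suc x) i
  Φ-suc⁺ i (1≤i , i<x , inj₁ nil)            = 1≤i , m<n⇒m<1+n i<x , inj₁ nil
  Φ-suc⁺ i (1≤i , i<x , inj₂ (y , fi≡y , y<x)) = 1≤i , m<n⇒m<1+n i<x , inj₂ (y , fi≡y , m<n⇒m<1+n y<x)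

  Φ-suc⁻ : ∀ i → Φ front (suc x) i → Φ front x i ⊎ i ≡ x ⊎ front i ≡ just x
  Φ-suc⁻ i (1≤i , s≤s i≤x , fi) with m≤n⇒m<n∨m≡n i≤x
  ... | inj₂ i≡x = inj₂ (inj₁ i≡x)
  ... | inj₁ i<x with fi
  ...   | inj₁ nil = inj₁ (1≤i , i<x , inj₁ nil)
  ...   | inj₂ (y , fi≡y , s≤s y≤x) with m≤n⇒m<n∨m≡n y≤x
  ...     | inj₁ y<x  = inj₁ (1≤i , i<x , inj₂ (y , fi≡y , y<x))
  ...     | inj₂ refl = inj₂ (inj₂ fi≡y)

  nil⇒Φ-suc-self : 1 ≤ x → front x ≡ nothing → Φ front (suc x) x
  nil⇒Φ-suc-self 1≤x nil = 1≤x , ≤-refl , inj₁ nil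

  front≡just⇒Φ-suc : ∀ {j} → 1 ≤ j → j < x → front j ≡ just x → Φ front (suc x) j
  front≡just⇒Φ-suc 1≤j j<x fj≡x = 1≤j , m<n⇒m<1+n j<x , inj₂ (x , fj≡x , ≤-refl)

  front≡just⇒¬Φ : ∀ {j} → front j ≡ just x → ¬ Φ front x j
  front≡just⇒¬Φ fj≡x (_ , _ , inj₁ nil) with trans (sym fj≡x) nil
  ... | ()
  front≡just⇒¬Φ fj≡x (_ , _ , inj₂ (y , fj≡y , y<x)) with trans (sym fj≡x) fj≡y
  ... | refl = <-irrefl refl y<x

module ValidFrontStep {n front} (valid : ValidFront n front) {x} (1≤x : 1 ≤ x) (x≤n : x ≤ n) where
  open ValidFront valid
  open ΦStep front x public

  Φ-suc-self⇒nil : Φ front (suc x) x → front x ≡ nothing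
  Φ-suc-self⇒nil (_ , _ , inj₁ nil) = nil
  Φ-suc-self⇒nil (_ , _ , inj₂ (y , fx≡y , s≤s y≤x)) =
    ⊥-elim (<-irrefl refl (<-≤-trans (proj₁ (range x y 1≤x x≤n fx≡y)) y≤x))

  frontInv⇒¬nil : ∀ {j} → IsFrontInv n front x j → ¬ front x ≡ nothing
  frontInv⇒¬nil {j} (1≤j , j≤n , fj≡x) with invariant j x 1≤j j≤n fj≡x
  ... | inj₁ refl  = ⊥-elim (<-irrefl refl (s≤s x≤n))
  ... | inj₂ ¬nil = ¬nil

  frontInv⇒< : ∀ {j} → IsFrontInv n front x j → j < x
  frontInv⇒< (1≤j , j≤n , fj≡x) = proj₁ (range _ x 1≤j j≤n fj≡x)

  Φ-suc⁻-frontInv : ∀ i → Φ front (suc x) i → Φ front x i ⊎ i ≡ x ⊎ IsFrontInv n front x i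
  Φ-suc⁻-frontInv i Φi@(1≤i , s≤s i≤x , _) with Φ-suc⁻ i Φi
  ... | inj₁ Φxi         = inj₁ Φxi
  ... | inj₂ (inj₁ i≡x)  = inj₂ (inj₁ i≡x)
  ... | inj₂ (inj₂ fi≡x) = inj₂ (inj₂ (1≤i , ≤-trans i≤x x≤n , fi≡x))

  Φ-suc-new : ∀ {i} → (Φ front (suc x) ∩ ∁ (Φ front x)) i → i ≡ x ⊎ IsFrontInv n front x i
  Φ-suc-new {i} (Φi , ¬Φxi) with Φ-suc⁻-frontInv i Φi
  ... | inj₁ Φxi = ⊥-elim (¬Φxi Φxi)
  ... | inj₂ new = new

  Φ-suc-new-unique : ∀ {i j} → (Φ front (suc x) ∩ ∁ (Φ front x)) i →
    (Φ front (suc x) ∩ ∁ (Φ front x)) j → i ≡ j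
  Φ-suc-new-unique newi newj with Φ-suc-new newi | Φ-suc-new newj
  ... | inj₁ refl | inj₁ refl = refl
  ... | inj₁ refl | inj₂ invj = ⊥-elim (frontInv⇒¬nil invj (Φ-suc-self⇒nil (proj₁ newi)))
  ... | inj₂ invi | inj₁ refl = ⊥-elim (frontInv⇒¬nil invi (Φ-suc-self⇒nil (proj₁ newj)))
  ... | inj₂ (1≤i , i≤n , fi≡x) | inj₂ (1≤j , j≤n , fj≡x) =
    atMostOne x _ _ 1≤x x≤n 1≤i i≤n 1≤j j≤n fi≡x fj≡x

  Φ-suc-stable⇔InK : (∀ i → (Φ front (suc x) i ⇔ Φ front x i)) ⇔ InK n front x
  Φ-suc-stable⇔InK = mk⇔ stable⇒InK InK⇒stable
    where
    stable⇒InK : (∀ i → (Φ front (suc x) i ⇔ Φ front x i)) → InK n front x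
    stable⇒InK stable = 1≤x , x≤n , ¬nil , ¬inv
      where
      ¬nil : ¬ front x ≡ nothing
      ¬nil nil = Φ-irrefl (Equivalence.to (stable x) (nil⇒Φ-suc-self 1≤x nil))
      ¬inv : ∀ j → ¬ IsFrontInv n front x j
      ¬inv j inv@(1≤j , _ , fj≡x) =
        front≡just⇒¬Φ fj≡x (Equivalence.to (stable j) (front≡just⇒Φ-suc 1≤j (frontInv⇒< inv) fj≡x))

    InK⇒stable : InK n front x → ∀ i → (Φ front (suc x) i ⇔ Φ front x i)
    InK⇒stable (_ , _ , ¬nil , ¬inv) i = mk⇔ Φ-suc⇒Φ (Φ-suc⁺ i)
      where
      Φ-suc⇒Φ : Φ front (suc x) i → Φ front x i
      Φ-suc⇒Φ Φi with Φ-suc⁻-frontInv i Φi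
      ... | inj₁ Φxi         = Φxi
      ... | inj₂ (inj₁ refl) = ⊥-elim (¬nil (Φ-suc-self⇒nil Φi))
      ... | inj₂ (inj₂ inv)  = ⊥-elim (¬inv i inv)

  φ-suc-≤ : φ front (suc x) ≤ suc (φ front x)
  φ-suc-≤ = begin
    φ front (suc x)
      ≤⟨ length-filter-≤-suc (Φ? front (suc x)) (Φ? front x) Φ-suc-new-unique (upTo⁺ (suc x)) ⟩
    suc (length (filter (Φ? front x) (upTo (suc x))))
      ≡⟨ cong suc (length-filter-upTo-suc (Φ? front x) Φ-irrefl) ⟩
    suc (φ front x)
      ∎
    where open Data.Nat.Properties.≤-Reasoning

lemma5 : (n : ℕ) → 2 ≤ n → (front : Front) → ValidFront n front →
    (x : ℕ) → 1 ≤ x → x < n →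
    ((∀ i → Φ front x i → Φ front (suc x) i)
      × (∀ i → Φ front (suc x) i → Φ front x i ⊎ i ≡ x ⊎ IsFrontInv n front x i))
    × ((∀ i → (Φ front (suc x) i ⇔ Φ front x i)) ⇔ InK n front x)
    × φ front (suc x) ≤ suc (φ front x)
lemma5 n _ front valid x 1≤x x<n = (Φ-suc⁺ , Φ-suc⁻-frontInv) , Φ-suc-stable⇔InK , φ-suc-≤
  where open ValidFrontStep valid 1≤x (<⇒≤ x<n)
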